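{- Let $s$ and $n\ge2$ be positive integers, $0\le k\le n$, and let $d\ge3$ be a common divisor of $2s(n-1)+2$ and $2k$. If some element of $W(s,n,k,d)$ contains a (colored) diameter, then $d$ divides $n$.
   Context: Let $M=s(n-1)+1$; the vertices of the $(2M)$-gon $P$ are labeled $1,\dots,M,\bar1,\dots,\bar M$ counterclockwise, $\bar{\bar a}=a$. A diagonal is $s$-divisible if it cuts $P$ into two polygons each with a number of vertices $\equiv2\pmod s$. For $1\le j\le M$ let $L_j$ be the diameter joining $j$ and $\bar j$; each diameter comes in a red and a blue copy. A $D$-diagonal is a colored diameter or an unordered pair $\{ij,\bar i\bar j\}$ with $ij$ an $s$-divisible non-diameter diagonal. $\Gamma_s$ rotates $P$ clockwise by one vertex (vertex $2\mapsto1$, $1\mapsto\bar M$, ...), and a colored diameter $L_j$ goes to the rotated diameter with color switched iff $j=1$ or $j\equiv2\pmod s$. Compatibility: two diameters with the same endpoints and different colors are compatible; two diameters with distinct endpoints are compatible iff after applying $\Gamma_s$ repeatedly until one of them becomes $L_1$ the two resulting diameters have the same color; otherwise two $D$-diagonals are compatible iff their constituent diagonals do not cross in the interior. For $d$ dividing $2M$, $W(s,n,k,d)$ is the set of $k$-element sets of pairwise compatible $D$-diagonals that are fixed by $\Gamma_s^{2M/d}$. -}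

module Defs where

open import Data.Nat using (ℕ; zero; suc; _+_; _*_; _∸_; _≤_; _<_; _⊓_; _⊔_; _≟_; _<?_; NonZero)
open import Data.Nat.DivMod using (_/_)
open import Data.Bool using (Bool; true; false; if_then_else_; _∨_)
open import Data.Product using (Σ; _×_; _,_; ∃; ∃-syntax)
open import Data.Sum using (_⊎_)
open import Data.Empty using (⊥)
open import Data.List using (List; []; _∷_; length)
open import Data.List.Membership.Propositional using (_∈_)
open import Data.List.Relation.Unary.All using (All)
open import Data.List.Relation.Unary.Unique.Propositional using (Unique)
open import Relation.Nullary using (¬_; yes; no; does)
open import Relation.Binary.PropositionalEquality using (_≡_; _≢_)

-- M = s(n-1)+1; the polygon P has 2M vertices.
-- Vertex POSITIONS are natural numbers 0,…,2M-1 counterclockwise: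
-- position p < M is the vertex labelled p+1, position M+p is the vertex
-- labelled bar(p+1).

Mval : ℕ → ℕ → ℕ
Mval s n = s * (n ∸ 1) + 1

Congr : ℕ → ℕ → ℕ → Set
Congr s x y = Σ ℕ λ p → Σ ℕ λ q → x + p * s ≡ y + q * s

bar : ℕ → ℕ → ℕ
bar M p = if does (p <? M) then p + M else p ∸ M

-- clockwise rotation by one vertex: position p ↦ p-1 (mod 2M)
rot : ℕ → ℕ → ℕ
rot M zero    = (M + M) ∸ 1
rot M (suc p) = p

Diag : Set
Diag = ℕ × ℕ

Cross : Diag → Diag → Set
Cross (x , y) (u , v) = (In u × Out v) ⊎ (Out u × In v)
  where
  a = x ⊓ y
  b = x ⊔ y
  In : ℕ → Set
  In w = (a < w) × (w < b)
  Out : ℕ → Set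
  Out w = (w < a) ⊎ (b < w)

-- diagonal {a,b}, a < b, is s-divisible: both polygons it cuts P into
-- have a number of vertices ≡ 2 (mod s)
SDivisible : (s M a b : ℕ) → Set
SDivisible s M a b = Congr s (b ∸ a + 1) 2 × Congr s ((M + M) ∸ (b ∸ a) + 1) 2

-- D-diagonals.
--   diam j c : the diameter L_j (1 ≤ j ≤ M, joining positions j-1 and
--              j-1+M) with colour c.
--   pair a b : the unordered pair {ab, bar a bar b} of centrally symmetric
--              non-diameter diagonals, stored in the canonical form
--              a < M, a + 2 ≤ b < a + M (every such pair has exactly one
--              representative diagonal {a,b} of this form).

data Colour : Set where
  red blue : Colour

flip : Colour → Colour
flip red  = blue
flip blue = red

data DDiag : Set where
  diam : ℕ → Colour → DDiag
  pair : ℕ → ℕ → DDiag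

ValidD : (s n : ℕ) → DDiag → Set
ValidD s n (diam j c) = (1 ≤ j) × (j ≤ Mval s n)
ValidD s n (pair a b) =
  (a < Mval s n) × (a + 2 ≤ b) × (b < a + Mval s n) × SDivisible s (Mval s n) a b

-- canonical representative of the pair {xy, bar x bar y}
-- (x ≠ y, not a diameter)
normalize : ℕ → ℕ → ℕ → DDiag
normalize M x y =
  if does (a <? M)
  then (if does (b <? a + M) then pair a b else pair (b ∸ M) (a + M))
  else pair (a ∸ M) (b ∸ M)
  where
  a = x ⊓ y
  b = x ⊔ y

constituents : ℕ → DDiag → List Diag
constituents M (diam j c) = ((j ∸ 1) , (j ∸ 1) + M) ∷ []
constituents M (pair a b) = (a , b) ∷ (bar M a , bar M b) ∷ []

-- Boolean test "j ≡ 2 (mod s)", by bounded search: for s ≥ 1 (and also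
-- s = 0) j ≡ 2 (mod s) iff for some t ≤ j, j = 2 + t*s or 2 = j + t*s.
anyUpTo : ℕ → (ℕ → Bool) → Bool
anyUpTo zero    f = f 0
anyUpTo (suc t) f = f (suc t) ∨ anyUpTo t f

congr2B : (s j : ℕ) → Bool
congr2B s j = anyUpTo j (λ t → does ((2 + t * s) ≟ j) ∨ does ((j + t * s) ≟ 2))

-- Γ_s on the colored diameter L_j (j is the 1-based index):
-- L_1 ↦ L_M, L_j ↦ L_{j-1} (j ≥ 2); colour switched iff j = 1 or j ≡ 2 (mod s)
Γdiam : (s M : ℕ) → ℕ → Colour → DDiag
Γdiam s M j c =
  if does (j ≟ 1) then diam M (flip c)
  else diam (j ∸ 1) (if congr2B s j then flip c else c)

Γ : (s n : ℕ) → DDiag → DDiag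
Γ s n (diam j c) = Γdiam s (Mval s n) j c
Γ s n (pair a b) = normalize M (rot M a) (rot M b)
  where M = Mval s n

iter : {A : Set} → ℕ → (A → A) → A → A
iter zero    f x = x
iter (suc m) f x = f (iter m f x)

colourOf : DDiag → Colour
colourOf (diam _ c) = c
colourOf (pair _ _) = red

NoCross : List Diag → List Diag → Set
NoCross ds es = ∀ {e f} → e ∈ ds → f ∈ es → ¬ Cross e f

Compatible : (s n : ℕ) → DDiag → DDiag → Set
Compatible s n (diam i c) (diam j c') with i ≟ j
... | yes _ = c ≢ c'
... | no  _ = colourOf (iter m (Γ s n) (diam i c)) ≡ colourOf (iter m (Γ s n) (diam j c'))
  where
  -- apply Γ_s until one of them becomes L_1: L_i becomes L_1 after i-1 steps
  m = (i ⊓ j) ∸ 1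
Compatible s n x y = NoCross (constituents (Mval s n) x) (constituents (Mval s n) y)

-- W(s,n,k,d): k-element sets (duplicate-free lists) of pairwise compatible
-- D-diagonals fixed (as sets) by Γ_s^{2M/d}.

FixedBy : (DDiag → DDiag) → List DDiag → Set
FixedBy g S = (∀ {x} → x ∈ S → g x ∈ S) × (∀ {y} → y ∈ S → ∃[ x ] (x ∈ S × g x ≡ y))

record W (s n k d : ℕ) .{{_ : NonZero d}} (S : List DDiag) : Set where
  field
    valid      : All (ValidD s n) S
    distinct   : Unique S
    card       : length S ≡ k
    compatible : ∀ {x y} → x ∈ S → y ∈ S → x ≢ y → Compatible s n x y
    fixed      : FixedBy (iter ((2 * Mval s n) / d) (Γ s n)) S

-- Read the Γ_s-orbit of a coloured diameter backwards: Q steps before a given diameter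
-- one finds L_{(Q mod M)+1}, with its colour switched flipCount Q times, where
-- flipCount x = ⌈x/s⌉ for x ≤ M and flipCount grows by n every M steps. If S is
-- fixed by Γ_s^r (r = 2M/d) and contains a diameter, it contains the d diameters of
-- that diameter's Γ_s^r-orbit, and their pairwise compatibility forces flipCount (t r)
-- to be even whenever 0 < t < d and t r ≠ M. Increments of flipCount over windows of
-- a fixed length take two consecutive values, so these parities make flipCount
-- linear on the multiples of r (d even) or of r/2 (d odd) up to M; evaluating at M,
-- where flipCount M = n, gives d ∣ n.

module Submission where

open import Defs
open import Data.Bool using (Bool; true; false; not; _∧_; _∨_; _xor_; if_then_else_)
open import Data.Bool.Properties using (not-¬; ∧-zeroʳ; ∧-identityʳ; not-distribˡ-xor; xor-same; xor-identityʳ; ∨-zeroʳ)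
open import Data.Nat using (ℕ; zero; suc; _+_; _*_; _∸_; _⊓_; _≤_; _<_; _≟_; NonZero; ≢-nonZero; ≢-nonZero⁻¹; >-nonZero; z≤n; s≤s; z<s)
open import Data.Nat.Properties
open import Data.Nat.DivMod using (_%_; _/_; m≡m%n+[m/n]*n; [m+kn]%n≡m%n; [m+n]%n≡m%n; m<n⇒m%n≡m; m*n/n≡m; n%n≡0; m%n<n; m%n%n≡m%n)
open import Data.Nat.Divisibility using (_∣_; divides; _∣?_; _∣0)
open import Data.Product using (_×_; _,_; ∃-syntax; proj₁; proj₂)
open import Data.Sum using (_⊎_; inj₁; inj₂)
open import Relation.Nullary using (Dec; yes; no; does; contradiction)
open import Relation.Nullary.Decidable using (dec-true; dec-false)
open import Relation.Binary.PropositionalEquality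
open import Data.List using (List)
open import Data.List.Membership.Propositional using (_∈_)
import Data.List.Relation.Unary.All as All
open import Data.Nat.Tactic.RingSolver using (solve-∀)

odd : ℕ → Bool
odd zero    = false
odd (suc m) = not (odd m)

odd-+ : ∀ m n → odd (m + n) ≡ odd m xor odd n
odd-+ zero    n = refl
odd-+ (suc m) n = trans (cong not (odd-+ m n)) (not-distribˡ-xor (odd m) (odd n))

odd-* : ∀ m n → odd (m * n) ≡ odd m ∧ odd n
odd-* zero    n = refl
odd-* (suc m) n = begin
  odd (n + m * n)             ≡⟨ odd-+ n (m * n) ⟩
  odd n xor odd (m * n)       ≡⟨ cong (odd n xor_) (odd-* m n) ⟩
  odd n xor (odd m ∧ odd n)   ≡⟨ xor-∧ (odd m) (odd n) ⟩
  not (odd m) ∧ odd n         ∎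
  where
  open ≡-Reasoning
  xor-∧ : ∀ x y → y xor (x ∧ y) ≡ not x ∧ y
  xor-∧ true  true  = refl
  xor-∧ true  false = refl
  xor-∧ false true  = refl
  xor-∧ false false = refl

odd-double : ∀ m → odd (m + m) ≡ false
odd-double m = trans (odd-+ m m) (xor-same (odd m))

odd-+-double : ∀ m k → odd (m + 2 * k) ≡ odd m
odd-+-double m k = trans (odd-+ m (2 * k)) (trans (cong (odd m xor_) (odd-* 2 k)) (xor-identityʳ (odd m)))

odd-sum-even⇒≡ : ∀ m n → odd (m + n) ≡ false → odd m ≡ odd n
odd-sum-even⇒≡ m n even with odd m | odd n | trans (sym (odd-+ m n)) even
... | true  | true  | _ = refl
... | false | false | _ = refl

∧-xor-cancel : ∀ x p y → (x ∧ p) xor y ≡ not x ∧ p → y ≡ p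
∧-xor-cancel false p     y     eq = eq
∧-xor-cancel true  true  true  eq = refl
∧-xor-cancel true  false false eq = refl

xor-≡ʳ⇒false : ∀ x y → x xor y ≡ y → x ≡ false
xor-≡ʳ⇒false false y     eq = refl
xor-≡ʳ⇒false true  false ()
xor-≡ʳ⇒false true  true  ()

half-mono-< : ∀ u w → u + u < w + w → u < w
half-mono-< u w u+u<w+w = ≰⇒> (λ w≤u → <⇒≱ u+u<w+w (+-mono-≤ w≤u w≤u))

even-*-odd⇒even : ∀ m n → odd n ≡ true → odd (m * n) ≡ false → odd m ≡ false
even-*-odd⇒even m n odd-n even-mn = begin
  odd m            ≡⟨ ∧-identityʳ (odd m) ⟨
  odd m ∧ true     ≡⟨ cong (odd m ∧_) odd-n ⟨
  odd m ∧ odd n    ≡⟨ odd-* m n ⟨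
  odd (m * n)      ≡⟨ even-mn ⟩
  false            ∎
  where open ≡-Reasoning

double-or-suc-double : ∀ m → (∃[ h ] m ≡ h + h) ⊎ (∃[ h ] m ≡ suc (h + h))
double-or-suc-double zero = inj₁ (0 , refl)
double-or-suc-double (suc m) with double-or-suc-double m
... | inj₁ (h , m≡h+h)   = inj₂ (h , cong suc m≡h+h)
... | inj₂ (h , m≡1+h+h) = inj₁ (suc h , cong suc (trans m≡1+h+h (sym (+-suc h h))))

even⇒double : ∀ m → odd m ≡ false → ∃[ h ] m ≡ h + h
even⇒double m even with double-or-suc-double m
... | inj₁ half = half
... | inj₂ (h , refl) with () ← trans (sym (cong not (odd-double h))) even

flip-involutive : ∀ c → flip (flip c) ≡ c
flip-involutive red  = refl
flip-involutive blue = refl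

flipIf : Bool → Colour → Colour
flipIf b c = if b then flip c else c

flipIf-not : ∀ b c → flipIf (not b) c ≡ flip (flipIf b c)
flipIf-not true  c = sym (flip-involutive c)
flipIf-not false c = refl

flipIf-involutive : ∀ b c → flipIf b (flipIf b c) ≡ c
flipIf-involutive true  c = flip-involutive c
flipIf-involutive false c = refl

flipIf-injective : ∀ x y c → flipIf x c ≡ flipIf y c → x ≡ y
flipIf-injective true  true  c eq = refl
flipIf-injective false false c eq = refl
flipIf-injective true  false red  ()
flipIf-injective true  false blue ()
flipIf-injective false true  red  ()
flipIf-injective false true  blue ()

does-true : ∀ {A : Set} (a? : Dec A) → does a? ≡ true → A
does-true (yes a) _ = a

anyUpTo-sound : ∀ K f → anyUpTo K f ≡ true → ∃[ t ] t ≤ K × f t ≡ true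
anyUpTo-sound zero    f eq = 0 , z≤n , eq
anyUpTo-sound (suc K) f eq with f (suc K) in fK
... | true  = suc K , ≤-refl , fK
... | false with t , t≤K , ft ← anyUpTo-sound K f eq = t , m≤n⇒m≤1+n t≤K , ft

anyUpTo-complete : ∀ K f {t} → t ≤ K → f t ≡ true → anyUpTo K f ≡ true
anyUpTo-complete zero    f z≤n ft = ft
anyUpTo-complete (suc K) f t≤1+K ft with m≤n⇒m<n∨m≡n t≤1+K
... | inj₂ refl = cong (_∨ anyUpTo K f) ft
... | inj₁ (s≤s t≤K) = trans (cong (f (suc K) ∨_) (anyUpTo-complete K f t≤K ft)) (∨-zeroʳ (f (suc K)))

congr2B-test : ℕ → ℕ → ℕ → Bool
congr2B-test s j t = does ((2 + t * s) ≟ j) ∨ does ((j + t * s) ≟ 2)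

congr2B-sound : ∀ s y → congr2B s (2 + y) ≡ true → s ∣ y
congr2B-sound s y eq
  with t , _ , ft ← anyUpTo-sound (2 + y) (congr2B-test s (2 + y)) eq
  with does ((2 + t * s) ≟ (2 + y)) in first
... | true  = divides t (sym (+-cancelˡ-≡ 2 _ _ (does-true ((2 + t * s) ≟ (2 + y)) first)))
... | false with refl ← m+n≡0⇒m≡0 y (+-cancelˡ-≡ 2 _ 0 (does-true ((2 + y + t * s) ≟ 2) ft)) = s ∣0

congr2B-complete : ∀ s y .{{_ : NonZero s}} → s ∣ y → congr2B s (2 + y) ≡ true
congr2B-complete s .(t * s) (divides t refl) =
  anyUpTo-complete (2 + t * s) (congr2B-test s (2 + t * s)) (≤-trans (m≤m*n t s) (m≤n+m (t * s) 2))
    (cong (_∨ does ((2 + t * s + t * s) ≟ 2)) (dec-true ((2 + t * s) ≟ (2 + t * s)) refl))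

congr2B-correct : ∀ s y .{{_ : NonZero s}} → congr2B s (2 + y) ≡ does (s ∣? y)
congr2B-correct s y with s ∣? y
... | yes s∣y = congr2B-complete s y s∣y
... | no  s∤y with congr2B s (2 + y) in eq
...   | true  = contradiction (congr2B-sound s y eq) s∤y
...   | false = refl

iter-+ : ∀ {A : Set} a b (f : A → A) x → iter (a + b) f x ≡ iter a f (iter b f x)
iter-+ zero    b f x = refl
iter-+ (suc a) b f x = cong f (iter-+ a b f x)

iter-* : ∀ {A : Set} t r (f : A → A) x → iter t (iter r f) x ≡ iter (t * r) f x
iter-* zero    r f x = refl
iter-* (suc t) r f x = trans (cong (iter r f) (iter-* t r f x)) (sym (iter-+ r (t * r) f x))

iter-preserves : ∀ {A : Set} {P : A → Set} {f : A → A} → (∀ {x} → P x → P (f x)) → ∀ t {x} → P x → P (iter t f x)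
iter-preserves         step zero    p = p
iter-preserves {P = P} {f} step (suc t) p = step (iter-preserves {P = P} {f} step t p)

diam-compatible-colours : ∀ s n i j c c' → i ≢ j → Compatible s n (diam i c) (diam j c') →
  colourOf (iter ((i ⊓ j) ∸ 1) (Γ s n) (diam i c)) ≡ colourOf (iter ((i ⊓ j) ∸ 1) (Γ s n) (diam j c'))
diam-compatible-colours s n i j c c' i≢j compatible with i ≟ j
... | yes i≡j = contradiction i≡j i≢j
... | no  _   = compatible

-- The Γ_s-orbit of a diameter

suc-%-% : ∀ m n .{{_ : NonZero n}} → suc m % n ≡ suc (m % n) % n
suc-%-% m n = trans (cong (λ q → suc q % n) (m≡m%n+[m/n]*n m n)) ([m+kn]%n≡m%n (suc (m % n)) (m / n) n)

module Trajectory (s-1 n-1 : ℕ) where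

  s n M : ℕ
  s = suc s-1
  n = suc n-1
  M = Mval s n

  instance
    M-nonZero : NonZero M
    M-nonZero = ≢-nonZero (m+1+n≢0 (s * n-1))

  suc-%-cases : ∀ Q → (suc Q % M ≡ 0 × suc (Q % M) ≡ M) ⊎ suc Q % M ≡ suc (Q % M)
  suc-%-cases Q with m≤n⇒m<n∨m≡n (m%n<n Q M)
  ... | inj₁ 1+r<M = inj₂ (trans (suc-%-% Q M) (m<n⇒m%n≡m 1+r<M))
  ... | inj₂ 1+r≡M = inj₁ (trans (suc-%-% Q M) (trans (cong (_% M) 1+r≡M) (n%n≡0 M)) , 1+r≡M)

  -- The colour-switch flag of Γ_s on L_{(y mod M)+1}.
  flipAt : ℕ → Bool
  flipAt y = does (suc (y % M) ≟ 1) ∨ congr2B s (suc (y % M))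

  flipCount : ℕ → ℕ
  flipCount zero    = 0
  flipCount (suc y) = if flipAt (suc y) then suc (flipCount y) else flipCount y

  traj : Colour → ℕ → DDiag
  traj c Q = diam (suc (Q % M)) (flipIf (odd (flipCount Q)) c)

  Γ-traj : ∀ c Q → Γ s n (traj c (suc Q)) ≡ traj c Q
  Γ-traj c Q with suc-%-cases Q
  ... | inj₁ (wraps , 1+r≡M) rewrite wraps =
    cong₂ diam (sym 1+r≡M) (trans (cong flip (flipIf-not (odd (flipCount Q)) c)) (flip-involutive _))
  ... | inj₂ steps rewrite steps with congr2B s (suc (suc (Q % M)))
  ...   | true  = cong (diam _) (trans (cong flip (flipIf-not (odd (flipCount Q)) c)) (flip-involutive _))
  ...   | false = refl

  iter-Γ-traj : ∀ c m Q → iter m (Γ s n) (traj c (m + Q)) ≡ traj c Q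
  iter-Γ-traj c zero    Q = refl
  iter-Γ-traj c (suc m) Q = begin
    Γ s n (iter m (Γ s n) (traj c (suc m + Q)))  ≡⟨ cong (λ q → Γ s n (iter m (Γ s n) (traj c q))) (sym (+-suc m Q)) ⟩
    Γ s n (iter m (Γ s n) (traj c (m + suc Q)))  ≡⟨ cong (Γ s n) (iter-Γ-traj c m (suc Q)) ⟩
    Γ s n (traj c (suc Q))                       ≡⟨ Γ-traj c Q ⟩
    traj c Q                                     ∎
    where open ≡-Reasoning

  flipAt-wrap : ∀ y → y % M ≡ 0 → flipAt y ≡ true
  flipAt-wrap y wraps rewrite wraps = refl

  flipAt-suc : ∀ y → y < M → flipAt (suc y) ≡ does (s ∣? y)
  flipAt-suc y y<M with m≤n⇒m<n∨m≡n y<M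
  ... | inj₁ 1+y<M rewrite m<n⇒m%n≡m 1+y<M = congr2B-correct s y
  ... | inj₂ 1+y≡M = trans (flipAt-wrap (suc y) (trans (cong (_% M) 1+y≡M) (n%n≡0 M)))
    (sym (dec-true (s ∣? y) (divides n-1 (trans (suc-injective (trans 1+y≡M (+-comm (s * n-1) 1))) (*-comm s n-1)))))

  flipCount-flip : ∀ y → flipAt (suc y) ≡ true → flipCount (suc y) ≡ suc (flipCount y)
  flipCount-flip y flip rewrite flip = refl

  flipCount-noFlip : ∀ y → flipAt (suc y) ≡ false → flipCount (suc y) ≡ flipCount y
  flipCount-noFlip y noFlip rewrite noFlip = refl

  IsCeilQuot : ℕ → ℕ → Set
  IsCeilQuot x q = x ≤ s * q × s * q < x + s

  ceilQuot-mono : ∀ {x y q q'} → x ≤ y → IsCeilQuot x q → IsCeilQuot y q' → q ≤ q'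
  ceilQuot-mono {x} {y} {q} {q'} x≤y (_ , sq<x+s) (y≤sq' , _) = ≤-pred (*-cancelˡ-< s q (suc q') (begin-strict
    s * q        <⟨ sq<x+s ⟩
    x + s        ≤⟨ +-monoˡ-≤ s (≤-trans x≤y y≤sq') ⟩
    s * q' + s   ≡⟨ +-comm (s * q') s ⟩
    s + s * q'   ≡⟨ *-suc s q' ⟨
    s * suc q'   ∎))
    where open ≤-Reasoning

  ceilQuot-unique : ∀ {x q q'} → IsCeilQuot x q → IsCeilQuot x q' → q ≡ q'
  ceilQuot-unique ceil ceil' = ≤-antisym (ceilQuot-mono ≤-refl ceil ceil') (ceilQuot-mono ≤-refl ceil' ceil)

  ceilQuot-multiple : ∀ t → IsCeilQuot (t * s) t
  ceilQuot-multiple t = ≤-reflexive (*-comm t s) , subst (_< t * s + s) (*-comm t s) (m<m+n (t * s) z<s)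

  ceilQuot-suc-multiple : ∀ t → IsCeilQuot (suc (t * s)) (suc t)
  ceilQuot-suc-multiple t = lower , subst (_< suc (t * s) + s) (sym s*[1+t]≡t*s+s) (n<1+n (t * s + s))
    where
    open ≤-Reasoning
    s*[1+t]≡t*s+s : s * suc t ≡ t * s + s
    s*[1+t]≡t*s+s = trans (*-comm s (suc t)) (+-comm s (t * s))
    lower : suc (t * s) ≤ s * suc t
    lower = begin
      suc (t * s)  ≡⟨ +-comm 1 (t * s) ⟩
      t * s + 1    ≤⟨ +-monoʳ-≤ (t * s) (s≤s z≤n) ⟩
      t * s + s    ≡⟨ s*[1+t]≡t*s+s ⟨
      s * suc t    ∎

  flipCount-ceil : ∀ x → x ≤ M → IsCeilQuot x (flipCount x)
  flipCount-ceil zero    _ = z≤n , subst (_< s) (sym (*-zeroʳ s)) z<s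
  flipCount-ceil (suc x) 1+x≤M with flipCount-ceil x (<⇒≤ 1+x≤M) | s ∣? x
  ... | ceil | yes s∣x@(divides t refl) =
    subst (IsCeilQuot (suc x)) (sym (flipCount-flip x (trans (flipAt-suc x 1+x≤M) (dec-true (s ∣? x) s∣x))))
    (subst (λ q → IsCeilQuot (suc x) (suc q)) (sym (ceilQuot-unique ceil (ceilQuot-multiple t))) (ceilQuot-suc-multiple t))
  ... | ceil | no s∤x =
    subst (IsCeilQuot (suc x)) (sym (flipCount-noFlip x (trans (flipAt-suc x 1+x≤M) (dec-false (s ∣? x) s∤x))))
    ( ≤∧≢⇒< (proj₁ ceil) (λ x≡sq → s∤x (divides (flipCount x) (trans x≡sq (*-comm s (flipCount x)))))
    , m<n⇒m<1+n (proj₂ ceil))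

  ceilQuot-split-M : ∀ {x y a b} → x + y ≡ M → IsCeilQuot x a → IsCeilQuot y b → a + b ≡ n
  ceilQuot-split-M {x} {y} {a} {b} x+y≡M (x≤sa , sa<x+s) (y≤sb , sb<y+s) = ≤-antisym a+b≤n n≤a+b
    where
    open ≤-Reasoning
    +-shuffle : ∀ p q r t → (p + q) + (r + t) ≡ (p + r) + (q + t)
    +-shuffle = solve-∀
    M+2s≡1+s[n+1] : ∀ s n-1 → (s * n-1 + 1) + (s + s) ≡ suc (s * suc (suc n-1))
    M+2s≡1+s[n+1] = solve-∀
    n≤a+b : n ≤ a + b
    n≤a+b = *-cancelˡ-< s n-1 (a + b) (begin-strict
      s * n-1       <⟨ m<m+n (s * n-1) z<s ⟩
      s * n-1 + 1   ≡⟨ x+y≡M ⟨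
      x + y         ≤⟨ +-mono-≤ x≤sa y≤sb ⟩
      s * a + s * b ≡⟨ *-distribˡ-+ s a b ⟨
      s * (a + b)   ∎)
    a+b≤n : a + b ≤ n
    a+b≤n = ≤-pred (*-cancelˡ-< s (a + b) (suc n) (≤-pred (begin
      suc (suc (s * (a + b)))         ≡⟨ cong (λ z → suc (suc z)) (*-distribˡ-+ s a b) ⟩
      suc (suc (s * a + s * b))       ≡⟨ cong suc (+-suc (s * a) (s * b)) ⟨
      suc (s * a) + suc (s * b)       ≤⟨ +-mono-≤ sa<x+s sb<y+s ⟩
      (x + s) + (y + s)               ≡⟨ +-shuffle x s y s ⟩
      (x + y) + (s + s)               ≡⟨ cong (_+ (s + s)) x+y≡M ⟩
      (s * n-1 + 1) + (s + s)         ≡⟨ M+2s≡1+s[n+1] s n-1 ⟩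
      suc (s * suc n)                 ∎)))

  flipCount-complement : ∀ x → x ≤ M → flipCount x + flipCount (M ∸ x) ≡ n
  flipCount-complement x x≤M =
    ceilQuot-split-M (m+[n∸m]≡n x≤M) (flipCount-ceil x x≤M) (flipCount-ceil (M ∸ x) (m∸n≤m M x))

  flipCount-M : flipCount M ≡ n
  flipCount-M = flipCount-complement 0 z≤n

  flipAt-periodic : ∀ y → flipAt (y + M) ≡ flipAt y
  flipAt-periodic y = cong (λ r → does (suc r ≟ 1) ∨ congr2B s (suc r)) ([m+n]%n≡m%n y M)

  flipCount-+M : ∀ x → flipCount (x + M) ≡ flipCount x + n
  flipCount-+M zero = flipCount-M
  flipCount-+M (suc x) rewrite flipAt-periodic (suc x) | flipCount-+M x with flipAt (suc x)
  ... | true  = refl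
  ... | false = refl

  flipCount-+*M : ∀ x K → flipCount (x + K * M) ≡ flipCount x + K * n
  flipCount-+*M x zero    = trans (cong flipCount (+-identityʳ x)) (sym (+-identityʳ _))
  flipCount-+*M x (suc K) = begin
    flipCount (x + (M + K * M))  ≡⟨ cong flipCount (+-assoc x M (K * M)) ⟨
    flipCount (x + M + K * M)    ≡⟨ flipCount-+*M (x + M) K ⟩
    flipCount (x + M) + K * n    ≡⟨ cong (_+ K * n) (flipCount-+M x) ⟩
    flipCount x + n + K * n      ≡⟨ +-assoc (flipCount x) n (K * n) ⟩
    flipCount x + (n + K * n)    ∎
    where open ≡-Reasoning

  traj-+2M : ∀ c x → traj c (x + 2 * M) ≡ traj c x
  traj-+2M c x = cong₂ diam (cong suc ([m+kn]%n≡m%n x 2 M))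
    (cong (λ b → flipIf b c) (trans (cong odd (flipCount-+*M x 2)) (odd-+-double (flipCount x) n)))

  flipCount-complement-2M : ∀ D → D ≤ 2 * M → flipCount D + flipCount (2 * M ∸ D) ≡ 2 * n
  flipCount-complement-2M D D≤2M with ≤-total D M
  ... | inj₁ D≤M = begin
    flipCount D + flipCount (2 * M ∸ D)          ≡⟨ cong (λ x → flipCount D + flipCount x) (+-∸-comm (1 * M) D≤M) ⟩
    flipCount D + flipCount ((M ∸ D) + 1 * M)    ≡⟨ cong (flipCount D +_) (flipCount-+*M (M ∸ D) 1) ⟩
    flipCount D + (flipCount (M ∸ D) + 1 * n)    ≡⟨ +-assoc (flipCount D) _ (1 * n) ⟨
    flipCount D + flipCount (M ∸ D) + 1 * n      ≡⟨ cong (_+ 1 * n) (flipCount-complement D D≤M) ⟩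
    2 * n                                        ∎
    where open ≡-Reasoning
  ... | inj₂ M≤D with D' , refl ← m≤n⇒∃[o]m+o≡n M≤D = begin
    flipCount (M + D') + flipCount (2 * M ∸ (M + D'))
      ≡⟨ cong₂ (λ x y → flipCount x + flipCount y) (+-comm M D') 2M∸[M+D']≡M∸D' ⟩
    flipCount (D' + M) + flipCount (M ∸ D')            ≡⟨ cong (_+ flipCount (M ∸ D')) (flipCount-+M D') ⟩
    flipCount D' + n + flipCount (M ∸ D')              ≡⟨ +-rearrange (flipCount D') n _ ⟩
    flipCount D' + flipCount (M ∸ D') + 1 * n          ≡⟨ cong (_+ 1 * n) (flipCount-complement D' D'≤M) ⟩
    2 * n                                              ∎
    where
    open ≡-Reasoning
    +-rearrange : ∀ a b c → a + b + c ≡ a + c + 1 * b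
    +-rearrange = solve-∀
    2M∸[M+D']≡M∸D' : 2 * M ∸ (M + D') ≡ M ∸ D'
    2M∸[M+D']≡M∸D' = trans ([m+n]∸[m+o]≡n∸o M (M + 0) D') (cong (_∸ D') (+-identityʳ M))
    D'≤M : D' ≤ M
    D'≤M = +-cancelˡ-≤ M D' M (subst (M + D' ≤_) (cong (M +_) (+-identityʳ M)) D≤2M)

  odd-flipCount-reflect : ∀ D → D ≤ 2 * M → odd (flipCount D) ≡ odd (flipCount (2 * M ∸ D))
  odd-flipCount-reflect D D≤2M =
    odd-sum-even⇒≡ (flipCount D) _ (trans (cong odd (flipCount-complement-2M D D≤2M)) (odd-* 2 n))

  IsRoundedQuot : ℕ → ℕ → Set
  IsRoundedQuot h c = s * c < h + s × h < s * c + s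

  ceilQuot-difference : ∀ {A h a c} → IsCeilQuot A a → IsCeilQuot (A + h) (a + c) → IsRoundedQuot h c
  ceilQuot-difference {A} {h} {a} {c} (A≤sa , sa<A+s) (A+h≤s[a+c] , s[a+c]<A+h+s) =
    +-cancelˡ-< (s * a) (s * c) (h + s) (begin-strict
      s * a + s * c  ≡⟨ *-distribˡ-+ s a c ⟨
      s * (a + c)    <⟨ s[a+c]<A+h+s ⟩
      A + h + s      ≡⟨ +-assoc A h s ⟩
      A + (h + s)    ≤⟨ +-monoˡ-≤ (h + s) A≤sa ⟩
      s * a + (h + s) ∎)
    , +-cancelˡ-< A h (s * c + s) (begin-strict
      A + h          ≤⟨ A+h≤s[a+c] ⟩
      s * (a + c)    ≡⟨ *-distribˡ-+ s a c ⟩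
      s * a + s * c  <⟨ +-monoˡ-< (s * c) sa<A+s ⟩
      A + s + s * c  ≡⟨ +-assoc A s (s * c) ⟩
      A + (s + s * c) ≡⟨ cong (A +_) (+-comm s (s * c)) ⟩
      A + (s * c + s) ∎)
    where open ≤-Reasoning

  roundedQuot-≤-suc : ∀ {h c c'} → IsRoundedQuot h c → IsRoundedQuot h c' → c ≤ suc c'
  roundedQuot-≤-suc {h} {c} {c'} (sc<h+s , _) (_ , h<sc'+s) = ≤-pred (*-cancelˡ-< s c (suc (suc c')) (begin-strict
    s * c              <⟨ sc<h+s ⟩
    h + s              <⟨ +-monoˡ-< s h<sc'+s ⟩
    s * c' + s + s     ≡⟨ s*[2+c]≡s*c+s+s s c' ⟨
    s * suc (suc c')   ∎))
    where
    open ≤-Reasoning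
    s*[2+c]≡s*c+s+s : ∀ s c → s * suc (suc c) ≡ s * c + s + s
    s*[2+c]≡s*c+s+s = solve-∀

  roundedQuot-unique-by-parity : ∀ {h c c'} → IsRoundedQuot h c → IsRoundedQuot h c' → odd c ≡ odd c' → c ≡ c'
  roundedQuot-unique-by-parity {c = c} {c'} rq rq' same with m≤n⇒m<n∨m≡n (roundedQuot-≤-suc rq rq')
                                                      | m≤n⇒m<n∨m≡n (roundedQuot-≤-suc rq' rq)
  ... | inj₂ refl | _         = contradiction (sym same) (not-¬ refl)
  ... | inj₁ _    | inj₂ refl = contradiction same (not-¬ refl)
  ... | inj₁ c<1+c' | inj₁ c'<1+c = ≤-antisym (≤-pred c<1+c') (≤-pred c'<1+c)

  flipCount-window : ∀ A h → A + h ≤ M → ∃[ c ] flipCount (A + h) ≡ flipCount A + c × IsRoundedQuot h c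
  flipCount-window A h A+h≤M = c , sym a+c≡b , ceilQuot-difference ceilA (subst (IsCeilQuot (A + h)) (sym a+c≡b) ceilA+h)
    where
    ceilA    = flipCount-ceil A (≤-trans (m≤m+n A h) A+h≤M)
    ceilA+h  = flipCount-ceil (A + h) A+h≤M
    c = flipCount (A + h) ∸ flipCount A
    a+c≡b : flipCount A + c ≡ flipCount (A + h)
    a+c≡b = m+[n∸m]≡n (ceilQuot-mono (m≤m+n A h) ceilA ceilA+h)

  -- Each step adds an increment over a window of length h, which its parity pins down.
  flipCount-linear : ∀ h K p → K * h ≤ M →
    (∀ t → t ≤ K → odd (flipCount (t * h)) ≡ odd t ∧ p) →
    flipCount (K * h) ≡ K * flipCount h
  flipCount-linear h K p Kh≤M parity = go K ≤-refl
    where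
    open ≡-Reasoning
    go : ∀ t → t ≤ K → flipCount (t * h) ≡ t * flipCount h
    go zero    _     = refl
    go (suc t) 1+t≤K
      with c , step , rq ← flipCount-window (t * h) h (subst (_≤ M) (+-comm h (t * h)) (≤-trans (*-monoˡ-≤ h 1+t≤K) Kh≤M)) = begin
      flipCount (h + t * h)        ≡⟨ cong flipCount (+-comm h (t * h)) ⟩
      flipCount (t * h + h)        ≡⟨ step ⟩
      flipCount (t * h) + c        ≡⟨ cong₂ _+_ (go t (<⇒≤ 1+t≤K)) c≡h ⟩
      t * flipCount h + flipCount h ≡⟨ +-comm (t * flipCount h) (flipCount h) ⟩
      flipCount h + t * flipCount h ∎
      where
      [1+t]h≤M : suc t * h ≤ M
      [1+t]h≤M = ≤-trans (*-monoˡ-≤ h 1+t≤K) Kh≤M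
      odd-c : odd c ≡ p
      odd-c = ∧-xor-cancel (odd t) p (odd c) (begin
        (odd t ∧ p) xor odd c               ≡⟨ cong (_xor odd c) (parity t (<⇒≤ 1+t≤K)) ⟨
        odd (flipCount (t * h)) xor odd c   ≡⟨ odd-+ (flipCount (t * h)) c ⟨
        odd (flipCount (t * h) + c)         ≡⟨ cong odd step ⟨
        odd (flipCount (t * h + h))         ≡⟨ cong (λ x → odd (flipCount x)) (+-comm (t * h) h) ⟩
        odd (flipCount (suc t * h))         ≡⟨ parity (suc t) 1+t≤K ⟩
        not (odd t) ∧ p                     ∎)
      odd-h : odd (flipCount h) ≡ p
      odd-h = trans (cong (λ x → odd (flipCount x)) (sym (+-identityʳ h))) (parity 1 (≤-trans (s≤s z≤n) 1+t≤K))
      rounded-h : IsRoundedQuot h (flipCount h)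
      rounded-h with c₀ , step₀ , rq₀ ← flipCount-window 0 h (≤-trans (m≤n*m h (suc t)) [1+t]h≤M) =
        subst (IsRoundedQuot h) (sym step₀) rq₀
      c≡h : c ≡ flipCount h
      c≡h = roundedQuot-unique-by-parity rq rounded-h (trans odd-c (sym odd-h))

  traj-compatible⇒same-parity : ∀ c m Q Q' → (m + Q) % M ≢ (m + Q') % M → ((m + Q) % M) ⊓ ((m + Q') % M) ≡ m →
    Compatible s n (traj c (m + Q)) (traj c (m + Q')) → odd (flipCount Q) ≡ odd (flipCount Q')
  traj-compatible⇒same-parity c m Q Q' positions≢ min≡m compatible = flipIf-injective _ _ c (begin
    flipIf (odd (flipCount Q)) c                      ≡⟨ cong colourOf (iter-Γ-traj c m Q) ⟨
    colourOf (iter m (Γ s n) (traj c (m + Q)))        ≡⟨ cong (λ k → colourOf (iter k (Γ s n) (traj c (m + Q)))) min≡m ⟨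
    colourOf (iter k (Γ s n) (traj c (m + Q)))
      ≡⟨ diam-compatible-colours s n _ _ _ _ (λ eq → positions≢ (suc-injective eq)) compatible ⟩
    colourOf (iter k (Γ s n) (traj c (m + Q')))       ≡⟨ cong (λ k → colourOf (iter k (Γ s n) (traj c (m + Q')))) min≡m ⟩
    colourOf (iter m (Γ s n) (traj c (m + Q')))       ≡⟨ cong colourOf (iter-Γ-traj c m Q') ⟩
    flipIf (odd (flipCount Q')) c                     ∎)
    where
    open ≡-Reasoning
    k = ((m + Q) % M) ⊓ ((m + Q') % M)

  -- Compatibility along an orbit

  shift-position-≢ : ∀ e D → 0 < D → D < 2 * M → D ≢ M → (e + D) % M ≢ e
  shift-position-≢ e D 0<D D<2M D≢M same = D≢K*M ((e + D) / M) (+-cancelˡ-≡ e D _ (begin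
    e + D                          ≡⟨ m≡m%n+[m/n]*n (e + D) M ⟩
    (e + D) % M + (e + D) / M * M  ≡⟨ cong (_+ (e + D) / M * M) same ⟩
    e + (e + D) / M * M            ∎))
    where
    open ≡-Reasoning
    D≢K*M : ∀ K → D ≢ K * M
    D≢K*M zero          D≡0  = <⇒≢ 0<D (sym D≡0)
    D≢K*M (suc zero)    D≡M  = D≢M (trans D≡M (+-identityʳ M))
    D≢K*M (suc (suc K)) D≡KM = <⇒≱ D<2M (subst (2 * M ≤_) (sym D≡KM) (*-monoˡ-≤ M (s≤s (s≤s (z≤n {K})))))

  traj-shift-≢ : ∀ c e D → e < M → 0 < D → D < 2 * M → D ≢ M → traj c e ≢ traj c (e + D)
  traj-shift-≢ c e D e<M 0<D D<2M D≢M same =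
    shift-position-≢ e D 0<D D<2M D≢M (sym (trans (sym (m<n⇒m%n≡m e<M)) (suc-injective (diam-index same))))
    where
    diam-index : ∀ {i j c c'} → diam i c ≡ diam j c' → i ≡ j
    diam-index refl = refl

  traj-compatible-forward : ∀ c e D → e < M → e ≤ (e + D) % M → (e + D) % M ≢ e →
    Compatible s n (traj c e) (traj c (e + D)) → odd (flipCount D) ≡ false
  traj-compatible-forward c e D e<M e≤e' e'≢e compatible = sym (traj-compatible⇒same-parity c e 0 D
    (λ eq → e'≢e (sym (trans (sym e%M≡e) (trans (cong (_% M) (sym (+-identityʳ e))) eq))))
    (trans (cong (_⊓ ((e + D) % M)) (trans (cong (_% M) (+-identityʳ e)) e%M≡e)) (m≤n⇒m⊓n≡m e≤e'))
    (subst (λ x → Compatible s n (traj c x) (traj c (e + D))) (sym (+-identityʳ e)) compatible))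
    where
    e%M≡e = m<n⇒m%n≡m e<M

  -- Here the other diameter has the smaller index, so the colours are compared at its
  -- position and the flips counted are those on the complementary arc 2M ∸ D.
  traj-compatible-backward : ∀ c e D → e < M → D ≤ 2 * M → (e + D) % M ≤ e → (e + D) % M ≢ e →
    Compatible s n (traj c e) (traj c (e + D)) → odd (flipCount (2 * M ∸ D)) ≡ false
  traj-compatible-backward c e D e<M D≤2M e'≤e e'≢e compatible =
    xor-≡ʳ⇒false (odd (flipCount X)) (odd (K * n)) (begin
      odd (flipCount X) xor odd (K * n)  ≡⟨ odd-+ (flipCount X) (K * n) ⟨
      odd (flipCount X + K * n)          ≡⟨ cong odd (flipCount-+*M X K) ⟨
      odd (flipCount (X + K * M))        ≡⟨ cong (λ x → odd (flipCount x)) (+-comm X (K * M)) ⟩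
      odd (flipCount (K * M + X))        ≡⟨ traj-compatible⇒same-parity c e' (K * M + X) (K * M) positions≢ min≡e' compatible' ⟩
      odd (flipCount (K * M))            ≡⟨ cong odd (flipCount-+*M 0 K) ⟩
      odd (K * n)                        ∎)
    where
    e' = (e + D) % M
    K  = (e + D) / M
    X  = 2 * M ∸ D
    open ≡-Reasoning
    e+D≡e'+KM : e + D ≡ e' + K * M
    e+D≡e'+KM = m≡m%n+[m/n]*n (e + D) M
    e+2M≡e'+[KM+X] : e + 2 * M ≡ e' + (K * M + X)
    e+2M≡e'+[KM+X] = begin
      e + 2 * M          ≡⟨ cong (e +_) (m+[n∸m]≡n D≤2M) ⟨
      e + (D + X)        ≡⟨ +-assoc e D X ⟨
      e + D + X          ≡⟨ cong (_+ X) e+D≡e'+KM ⟩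
      e' + K * M + X     ≡⟨ +-assoc e' (K * M) X ⟩
      e' + (K * M + X)   ∎
    compatible' : Compatible s n (traj c (e' + (K * M + X))) (traj c (e' + K * M))
    compatible' = subst₂ (Compatible s n)
      (trans (sym (traj-+2M c e)) (cong (traj c) e+2M≡e'+[KM+X])) (cong (traj c) e+D≡e'+KM) compatible
    position₁ : (e' + (K * M + X)) % M ≡ e
    position₁ = begin
      (e' + (K * M + X)) % M  ≡⟨ cong (_% M) e+2M≡e'+[KM+X] ⟨
      (e + 2 * M) % M         ≡⟨ [m+kn]%n≡m%n e 2 M ⟩
      e % M                   ≡⟨ m<n⇒m%n≡m e<M ⟩
      e                       ∎
    position₂ : (e' + K * M) % M ≡ e'
    position₂ = trans ([m+kn]%n≡m%n e' K M) (m%n%n≡m%n (e + D) M)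
    positions≢ : (e' + (K * M + X)) % M ≢ (e' + K * M) % M
    positions≢ eq = e'≢e (sym (trans (sym position₁) (trans eq position₂)))
    min≡e' : ((e' + (K * M + X)) % M) ⊓ ((e' + K * M) % M) ≡ e'
    min≡e' = trans (cong₂ _⊓_ position₁ position₂) (m≥n⇒m⊓n≡n e'≤e)

  traj-compatible⇒flipCount-even : ∀ c e D → e < M → 0 < D → D < 2 * M → D ≢ M →
    Compatible s n (traj c e) (traj c (e + D)) → odd (flipCount D) ≡ false
  traj-compatible⇒flipCount-even c e D e<M 0<D D<2M D≢M compatible
    with ≤-total e ((e + D) % M) | shift-position-≢ e D 0<D D<2M D≢M
  ... | inj₁ e≤e' | e'≢e = traj-compatible-forward c e D e<M e≤e' e'≢e compatible
  ... | inj₂ e'≤e | e'≢e = trans (odd-flipCount-reflect D (<⇒≤ D<2M))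
                                 (traj-compatible-backward c e D e<M (<⇒≤ D<2M) e'≤e e'≢e compatible)

  -- Divisibility of n

  odd-flipCount-+M : ∀ x → odd (flipCount (x + M)) ≡ odd (flipCount x) xor odd n
  odd-flipCount-+M x = trans (cong odd (flipCount-+M x)) (odd-+ (flipCount x) n)

  EvenOrbitSteps : ℕ → ℕ → Set
  EvenOrbitSteps d r = ∀ t → 1 ≤ t → t < d → t * r ≢ M → odd (flipCount (t * r)) ≡ false

  evenOrbitSteps⇒[w+w]∣n : ∀ w r → 2 ≤ w → M ≡ w * r → EvenOrbitSteps (w + w) r → w + w ∣ n
  evenOrbitSteps⇒[w+w]∣n w r 2≤w M≡wr even = divides v (begin
    n                  ≡⟨ flipCount-M ⟨
    flipCount M        ≡⟨ cong flipCount M≡wr ⟩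
    flipCount (w * r)  ≡⟨ flipCount-linear r w false (≤-reflexive (sym M≡wr)) parity ⟩
    w * flipCount r    ≡⟨ cong (w *_) fr≡v+v ⟩
    w * (v + v)        ≡⟨ w*[v+v]≡v*[w+w] w v ⟩
    v * (w + w)        ∎)
    where
    open ≡-Reasoning
    w*[v+v]≡v*[w+w] : ∀ w v → w * (v + v) ≡ v * (w + w)
    w*[v+v]≡v*[w+w] = solve-∀
    0<r : 0 < r
    0<r = n≢0⇒n>0 (λ r≡0 → ≢-nonZero⁻¹ M (trans M≡wr (trans (cong (w *_) r≡0) (*-zeroʳ w))))
    t<w⇒tr<M : ∀ {t} → t < w → t * r < M
    t<w⇒tr<M {t} t<w = subst (t * r <_) (sym M≡wr) (*-monoˡ-< r {{>-nonZero 0<r}} t<w)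
    w<w+w : w < w + w
    w<w+w = m<m+n w (≤-trans (s≤s z≤n) 2≤w)
    1+w<w+w : suc w < w + w
    1+w<w+w = subst (_< w + w) (+-comm w 1) (+-monoʳ-< w 2≤w)
    odd-fr : odd (flipCount r) ≡ false
    odd-fr = trans (cong (λ x → odd (flipCount x)) (sym (+-identityʳ r)))
      (even 1 ≤-refl (≤-<-trans (≤-trans (s≤s z≤n) 2≤w) w<w+w) (<⇒≢ (t<w⇒tr<M 2≤w)))
    odd-n : odd n ≡ false
    odd-n = begin
      odd n                              ≡⟨ cong (_xor odd n) odd-fr ⟨
      odd (flipCount r) xor odd n        ≡⟨ odd-flipCount-+M r ⟨
      odd (flipCount (r + M))            ≡⟨ cong (λ x → odd (flipCount (r + x))) M≡wr ⟩
      odd (flipCount (suc w * r))        ≡⟨ even (suc w) (s≤s z≤n) 1+w<w+w (λ eq → <⇒≢ (m<n+m (w * r) 0<r) (sym (trans eq M≡wr))) ⟩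
      false                              ∎
    parity : ∀ t → t ≤ w → odd (flipCount (t * r)) ≡ odd t ∧ false
    parity zero    _   = refl
    parity (suc t) t≤w with m≤n⇒m<n∨m≡n t≤w
    ... | inj₁ t<w = trans (even (suc t) (s≤s z≤n) (<-trans t<w w<w+w) (<⇒≢ (t<w⇒tr<M t<w))) (sym (∧-zeroʳ (odd (suc t))))
    ... | inj₂ refl = begin
      odd (flipCount (w * r))  ≡⟨ cong (λ x → odd (flipCount x)) M≡wr ⟨
      odd (flipCount M)        ≡⟨ cong odd flipCount-M ⟩
      odd n                    ≡⟨ odd-n ⟩
      false                    ≡⟨ ∧-zeroʳ (odd w) ⟨
      odd w ∧ false            ∎
    v = proj₁ (even⇒double (flipCount r) odd-fr)
    fr≡v+v = proj₂ (even⇒double (flipCount r) odd-fr)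

  -- Odd multiples t m are moved by M = d m onto multiples of r = m + m.
  evenOrbitSteps⇒[1+w+w]∣n : ∀ w m → 0 < m → M ≡ suc (w + w) * m → EvenOrbitSteps (suc (w + w)) (m + m) → suc (w + w) ∣ n
  evenOrbitSteps⇒[1+w+w]∣n w m 0<m M≡dm even = divides (flipCount m) (begin
    n                  ≡⟨ flipCount-M ⟨
    flipCount M        ≡⟨ cong flipCount M≡dm ⟩
    flipCount (d * m)  ≡⟨ flipCount-linear m d (odd n) (≤-reflexive (sym M≡dm)) parity ⟩
    d * flipCount m    ≡⟨ *-comm d (flipCount m) ⟩
    flipCount m * d    ∎)
    where
    open ≡-Reasoning
    d = suc (w + w)
    [u+u]*m≡u*[m+m] : ∀ u m → (u + u) * m ≡ u * (m + m)
    [u+u]*m≡u*[m+m] = solve-∀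
    [1+u+w]*[m+m]≡[1+u+u]*m+[1+w+w]*m : ∀ u w m → suc (u + w) * (m + m) ≡ suc (u + u) * m + suc (w + w) * m
    [1+u+w]*[m+m]≡[1+u+u]*m+[1+w+w]*m = solve-∀
    odd-suc-double : ∀ u b → odd (suc (u + u)) ∧ b ≡ b
    odd-suc-double u b = cong (λ x → not x ∧ b) (odd-double u)
    t<d⇒tm<M : ∀ {t} → t < d → t * m < M
    t<d⇒tm<M {t} t<d = subst (t * m <_) (sym M≡dm) (*-monoˡ-< m {{>-nonZero 0<m}} t<d)
    parity : ∀ t → t ≤ d → odd (flipCount (t * m)) ≡ odd t ∧ odd n
    parity t t≤d with double-or-suc-double t
    ... | inj₁ (zero , refl)  = refl
    ... | inj₁ (suc u , refl) = begin
      odd (flipCount ((suc u + suc u) * m))   ≡⟨ cong (λ x → odd (flipCount x)) ([u+u]*m≡u*[m+m] (suc u) m) ⟩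
      odd (flipCount (suc u * (m + m)))
        ≡⟨ even (suc u) (s≤s z≤n) 1+u<d (λ eq → <⇒≢ (t<d⇒tm<M t<d) (trans ([u+u]*m≡u*[m+m] (suc u) m) eq)) ⟩
      false                                   ≡⟨ cong (_∧ odd n) (odd-double (suc u)) ⟨
      odd (suc u + suc u) ∧ odd n             ∎
      where
      t<d : suc u + suc u < d
      t<d = ≤∧≢⇒< t≤d (λ eq → contradiction (trans (sym (odd-double (suc u))) (trans (cong odd eq) (cong not (odd-double w))))
                                            λ ())
      1+u<d : suc u < d
      1+u<d = <-trans (m<m+n (suc u) z<s) t<d
    ... | inj₂ (u , refl) with m≤n⇒m<n∨m≡n t≤d
    ...   | inj₂ t≡d = begin
      odd (flipCount (suc (u + u) * m))  ≡⟨ cong (λ x → odd (flipCount (x * m))) t≡d ⟩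
      odd (flipCount (d * m))            ≡⟨ cong (λ x → odd (flipCount x)) M≡dm ⟨
      odd (flipCount M)                  ≡⟨ cong odd flipCount-M ⟩
      odd n                              ≡⟨ odd-suc-double u (odd n) ⟨
      odd (suc (u + u)) ∧ odd n          ∎
    ...   | inj₁ t<d = begin
      odd (flipCount t*m)              ≡⟨ odd-sum-even⇒≡ (flipCount t*m) n (begin
        odd (flipCount t*m + n)                  ≡⟨ cong odd (flipCount-+M t*m) ⟨
        odd (flipCount (t*m + M))                ≡⟨ cong (λ x → odd (flipCount x)) [1+u+w]*[m+m]≡t*m+M ⟨
        odd (flipCount (suc (u + w) * (m + m)))  ≡⟨ even (suc (u + w)) (s≤s z≤n) 1+u+w<d 1+u+w≢ ⟩
        false                                    ∎) ⟩
      odd n                            ≡⟨ odd-suc-double u (odd n) ⟨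
      odd (suc (u + u)) ∧ odd n        ∎
      where
      t*m = suc (u + u) * m
      [1+u+w]*[m+m]≡t*m+M : suc (u + w) * (m + m) ≡ t*m + M
      [1+u+w]*[m+m]≡t*m+M = trans ([1+u+w]*[m+m]≡[1+u+u]*m+[1+w+w]*m u w m) (cong (t*m +_) (sym M≡dm))
      1+u+w<d : suc (u + w) < d
      1+u+w<d = s≤s (+-monoˡ-< w (half-mono-< u w (≤-pred t<d)))
      1+u+w≢ : suc (u + w) * (m + m) ≢ M
      1+u+w≢ eq = <⇒≢ (m<n+m M (≤-trans 0<m (m≤n*m m (suc (u + u))))) (sym (trans (sym [1+u+w]*[m+m]≡t*m+M) eq))

  evenOrbitSteps⇒∣n : ∀ d r → 3 ≤ d → 2 * M ≡ r * d → EvenOrbitSteps d r → d ∣ n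
  evenOrbitSteps⇒∣n d r 3≤d 2M≡rd even with double-or-suc-double d
  ... | inj₁ (w , refl) = evenOrbitSteps⇒[w+w]∣n w r (half-mono-< 1 w 3≤d) M≡wr even
    where
    M≡wr : M ≡ w * r
    M≡wr = *-cancelˡ-≡ M (w * r) 2 (trans 2M≡rd (r*[w+w]≡2*[w*r] r w))
      where
      r*[w+w]≡2*[w*r] : ∀ r w → r * (w + w) ≡ 2 * (w * r)
      r*[w+w]≡2*[w*r] = solve-∀
  ... | inj₂ (w , refl)
    with m , refl ← even⇒double r (even-*-odd⇒even r _ (cong not (odd-double w)) (trans (cong odd (sym 2M≡rd)) (odd-* 2 M))) =
    evenOrbitSteps⇒[1+w+w]∣n w m 0<m M≡dm even
    where
    M≡dm : M ≡ suc (w + w) * m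
    M≡dm = *-cancelˡ-≡ M (suc (w + w) * m) 2 (trans 2M≡rd ([m+m]*d≡2*[d*m] m (suc (w + w))))
      where
      [m+m]*d≡2*[d*m] : ∀ m d → (m + m) * d ≡ 2 * (d * m)
      [m+m]*d≡2*[d*m] = solve-∀
    0<m : 0 < m
    0<m = n≢0⇒n>0 (λ m≡0 → ≢-nonZero⁻¹ M (trans M≡dm (trans (cong (suc (w + w) *_) m≡0) (*-zeroʳ (suc (w + w))))))

  traj-orbit : ∀ c e d r t → 2 * M ≡ r * d → t ≤ d →
    iter (d ∸ t) (iter r (Γ s n)) (traj c e) ≡ traj c (e + t * r)
  traj-orbit c e d r t 2M≡rd t≤d = begin
    iter (d ∸ t) (iter r (Γ s n)) (traj c e)               ≡⟨ iter-* (d ∸ t) r (Γ s n) (traj c e) ⟩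
    iter ((d ∸ t) * r) (Γ s n) (traj c e)                  ≡⟨ cong (iter ((d ∸ t) * r) (Γ s n)) (traj-+2M c e) ⟨
    iter ((d ∸ t) * r) (Γ s n) (traj c (e + 2 * M))        ≡⟨ cong (λ x → iter ((d ∸ t) * r) (Γ s n) (traj c x)) e+2M≡ ⟩
    iter ((d ∸ t) * r) (Γ s n) (traj c ((d ∸ t) * r + (e + t * r)))  ≡⟨ iter-Γ-traj c ((d ∸ t) * r) (e + t * r) ⟩
    traj c (e + t * r)                                     ∎
    where
    open ≡-Reasoning
    e+2M≡ : e + 2 * M ≡ (d ∸ t) * r + (e + t * r)
    e+2M≡ = begin
      e + 2 * M                      ≡⟨ cong (e +_) 2M≡rd ⟩
      e + r * d                      ≡⟨ cong (e +_) (*-comm r d) ⟩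
      e + d * r                      ≡⟨ cong (λ x → e + x * r) (m∸n+n≡m t≤d) ⟨
      e + (d ∸ t + t) * r            ≡⟨ cong (e +_) (*-distribʳ-+ r (d ∸ t) t) ⟩
      e + ((d ∸ t) * r + t * r)      ≡⟨ +-shuffle e ((d ∸ t) * r) (t * r) ⟩
      (d ∸ t) * r + (e + t * r)      ∎
      where
      +-shuffle : ∀ a b c → a + (b + c) ≡ b + (a + c)
      +-shuffle = solve-∀

  traj-through : ∀ c e → e < M → traj (flipIf (odd (flipCount e)) c) e ≡ diam (suc e) c
  traj-through c e e<M = cong₂ diam (cong suc (m<n⇒m%n≡m e<M)) (flipIf-involutive (odd (flipCount e)) c)

  W-diameter⇒evenOrbitSteps : ∀ {k d S} .{{_ : NonZero d}} → W s n k d S → ∀ r → 2 * M ≡ r * d →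
    ∀ e c → e < M → diam (suc e) c ∈ S → EvenOrbitSteps d r
  W-diameter⇒evenOrbitSteps {d = d} {S} w r 2M≡rd e c e<M L∈S t 1≤t t<d tr≢M =
    traj-compatible⇒flipCount-even b e (t * r) e<M 0<tr tr<2M tr≢M
      (W.compatible w start∈S shifted∈S (traj-shift-≢ b e (t * r) e<M 0<tr tr<2M tr≢M))
    where
    b = flipIf (odd (flipCount e)) c
    start∈S : traj b e ∈ S
    start∈S = subst (_∈ S) (sym (traj-through c e e<M)) L∈S
    2M/d≡r : (2 * M) / d ≡ r
    2M/d≡r = trans (cong (_/ d) 2M≡rd) (m*n/n≡m r d)
    shifted∈S : traj b (e + t * r) ∈ S
    shifted∈S = subst (_∈ S)
      (trans (cong (λ q → iter (d ∸ t) (iter q (Γ s n)) (traj b e)) 2M/d≡r) (traj-orbit b e d r t 2M≡rd (<⇒≤ t<d)))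
      (iter-preserves {P = _∈ S} (proj₁ (W.fixed w)) (d ∸ t) start∈S)
    0<r : 0 < r
    0<r = n≢0⇒n>0 (λ r≡0 → ≢-nonZero⁻¹ M (m+n≡0⇒m≡0 M (trans 2M≡rd (cong (_* d) r≡0))))
    0<tr : 0 < t * r
    0<tr = ≤-trans 0<r (m≤n*m r t {{>-nonZero 1≤t}})
    tr<2M : t * r < 2 * M
    tr<2M = subst (t * r <_) (trans (*-comm d r) (sym 2M≡rd)) (*-monoˡ-< r {{>-nonZero 0<r}} t<d)

lemma5p6 : (s n k d : ℕ) .{{_ : NonZero d}} →
    1 ≤ s → 2 ≤ n → k ≤ n → 3 ≤ d →
    d ∣ 2 * Mval s n → d ∣ 2 * k →
    (S : List DDiag) → W s n k d S →
    (∃[ j ] ∃[ c ] (diam j c ∈ S)) →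
    d ∣ n
lemma5p6 (suc s-1) (suc n-1) k d _ _ _ 3≤d (divides r 2M≡rd) _ S w (j , c , L∈S)
  with All.lookup (W.valid w) L∈S
... | s≤s z≤n , e<M = evenOrbitSteps⇒∣n d r 3≤d 2M≡rd (W-diameter⇒evenOrbitSteps w r 2M≡rd _ c e<M L∈S)
  where open Trajectory s-1 n-1
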